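{- Let $D=\begin{pmatrix} I_r & M\end{pmatrix}$ be an $r\times n$ standard representative matrix. For any two distinct $B_1,B_2\in\mathcal B(D)$, the parallelepipeds $P(B_1)$ and $P(B_2)$ intersect only at their boundaries, i.e. their interiors are disjoint.
   Context: Let $r\le n$ be nonnegative integers, $M$ an $r\times(n-r)$ integer matrix, $D=\begin{pmatrix} I_r & M\end{pmatrix}$, $\widehat D=\begin{pmatrix} -M^T & I_{n-r}\end{pmatrix}$. $\mathcal B(D)$ is the set of $r$-element subsets $B\subseteq[n]$ such that the submatrix of $D$ on the columns indexed by $B$ has nonzero determinant. The fundamental parallelepiped of vectors $c_1,\dots,c_k$ is $\{\sum_i a_ic_i: 0\le a_i\le 1\}$. For $B\in\mathcal B(D)$, $P_1(B)\subseteq\mathbb R^r$ is the fundamental parallelepiped of the columns of $D$ indexed by $B$, $P_2(B)\subseteq\mathbb R^{n-r}$ is that of the columns of $\widehat D$ indexed by $[n]\setminus B$, and $P(B)=P_1(B)\times P_2(B)\subseteq\mathbb R^n$.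
   Formalization: The parallelepipeds P(B) and their interiors are taken in ℚ^n, with rational coordinates and rational coefficients, rather than in ℝ^n. -}

module Defs where

open import Data.Nat using (ℕ; zero; suc) renaming (_+_ to _+ᴺ_)
open import Data.Bool using (Bool; true; false; if_then_else_)
open import Data.Fin using (Fin; zero; suc; splitAt; _↑ˡ_; _↑ʳ_; punchIn; cast; _≟_)
open import Data.Sum using (_⊎_; inj₁; inj₂)
open import Data.List using (List; []; _∷_; map; length; lookup)
open import Data.Vec using ([]; _∷_) renaming (lookup to vlookup)
open import Data.Fin.Subset using (Subset)
open import Data.Integer as ℤ using (ℤ; +_)
open import Data.Rational as ℚ using (ℚ; 0ℚ; 1ℚ; _/_)
open import Data.Product using (Σ; ∃; _×_; _,_)
open import Relation.Nullary using (¬_; yes; no)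
open import Relation.Binary.PropositionalEquality using (_≡_; _≢_)

sumℤ : ∀ {k} → (Fin k → ℤ) → ℤ
sumℤ {zero}  f = + 0
sumℤ {suc k} f = f zero ℤ.+ sumℤ (λ i → f (suc i))

sumℚ : ∀ {k} → (Fin k → ℚ) → ℚ
sumℚ {zero}  f = 0ℚ
sumℚ {suc k} f = f zero ℚ.+ sumℚ (λ i → f (suc i))

Matrix : ℕ → ℕ → Set
Matrix a b = Fin a → Fin b → ℤ

sgn : ∀ {k} → Fin k → ℤ
sgn zero    = + 1
sgn (suc j) = ℤ.- sgn j

det : ∀ {k} → Matrix k k → ℤ
det {zero}  A = + 1
det {suc k} A = sumℤ (λ j → sgn j ℤ.* (A zero j ℤ.* det (λ i j' → A (suc i) (punchIn j j'))))

-- The matrices D = (I_r  M) and D̂ = (-Mᵀ  I_m), with n = r + m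

δ : ∀ {k} → Fin k → Fin k → ℤ
δ i j with i ≟ j
... | yes _ = + 1
... | no  _ = + 0

Dmat : ∀ {r m} → Matrix r m → Matrix r (r +ᴺ m)
Dmat {r} M i j with splitAt r j
... | inj₁ j' = δ i j'
... | inj₂ k  = M i k

D̂mat : ∀ {r m} → Matrix r m → Matrix m (r +ᴺ m)
D̂mat {r} M k j with splitAt r j
... | inj₁ i  = ℤ.- M i k
... | inj₂ k' = δ k k'

elems : ∀ {n} → Subset n → List (Fin n)
elems []          = []
elems (true  ∷ p) = zero ∷ map suc (elems p)
elems (false ∷ p) = map suc (elems p)

_∈ᵇ_ : ∀ {n} → Fin n → Subset n → Bool
j ∈ᵇ B = vlookup B j

subCols : ∀ {r n} → Matrix r n → (B : Subset n) → r ≡ length (elems B) → Matrix r r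
subCols A B e i k = A i (lookup (elems B) (cast e k))

InBases : ∀ {r m} → Matrix r m → Subset (r +ᴺ m) → Set
InBases {r} M B = Σ (r ≡ length (elems B)) λ e → det (subCols (Dmat M) B e) ≢ + 0

ℤ→ℚ : ℤ → ℚ
ℤ→ℚ z = z / 1

Point : ℕ → Set
Point k = Fin k → ℚ

InPar : ∀ {a n} → Matrix a n → (Fin n → Bool) → Point a → Set
InPar {a} {n} A sel x =
  ∃ λ (c : Fin n → ℚ) →
    (∀ j → (0ℚ ℚ.≤ c j) × (c j ℚ.≤ 1ℚ)) ×
    (∀ i → x i ≡ sumℚ (λ j → if sel j then c j ℚ.* ℤ→ℚ (A i j) else 0ℚ))

notᵇ : Bool → Bool
notᵇ true  = false
notᵇ false = true

P : ∀ {r m} → Matrix r m → Subset (r +ᴺ m) → Point (r +ᴺ m) → Set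
P {r} {m} M B x =
  InPar (Dmat M) (λ j → j ∈ᵇ B) (λ i → x (i ↑ˡ m)) ×
  InPar (D̂mat M) (λ j → notᵇ (j ∈ᵇ B)) (λ k → x (r ↑ʳ k))

Interior : ∀ {k} → (Point k → Set) → Point k → Set
Interior {k} S x =
  ∃ λ (ε : ℚ) → (0ℚ ℚ.< ε) ×
    (∀ (y : Point k) → (∀ i → ℚ.∣ y i ℚ.- x i ∣ ℚ.< ε) → S y)

-- A point of P(B) is (D α, D̂ β) with α, β ≥ 0, α supported on B and β on its complement.
-- Since D̂ = (-Mᵀ I), the cross terms cancel in (D γ)·η₁ + (D̂ η)·γ₂ = γ·η.  For two
-- representations (α, β) of a point of P(B₁) and (α′, β′) of the same point in P(B₂), this
-- identity gives α·β′ + α′·β = α·β + α′·β′ = 0, so αⱼ β′ⱼ = 0 for every j.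
--
-- Take j ∈ B₁ ∖ B₂, a nonzero φ orthogonal to the columns of D indexed by B₁ ∖ {j}, and a
-- nonzero ψ orthogonal to the columns of D̂ indexed by ∁B₂ ∖ {j} (in both cases there are
-- fewer vectors than the dimension).  On P(B₁) ∩ P(B₂) we get φ·y = αⱼ (φ·Dⱼ) and
-- ψ·z = β′ⱼ (ψ·D̂ⱼ), so the intersection lies in the union of the hyperplanes φ·y = 0 and
-- ψ·z = 0, and that union contains no ball.

module Submission where

open import Defs
open import Data.Nat as ℕ using (ℕ; zero; suc)
import Data.Nat.Properties as ℕ
open import Data.Bool using (Bool; true; false; if_then_else_)
open import Data.Fin using (Fin; zero; suc; _↑ˡ_; _↑ʳ_; splitAt; punchIn; _≟_)
open import Data.Fin.Properties using (punchInᵢ≢i; splitAt-↑ˡ; splitAt-↑ʳ)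
open import Data.Fin.Subset using (Subset; ∁)
import Data.Integer as ℤ
open import Data.List using (List; []; _∷_; length; map; filter)
open import Data.List.Properties using (length-map; filter-notAll)
open import Data.List.Membership.Propositional using (_∈_)
open import Data.List.Membership.Propositional.Properties using (∈-map⁺; ∈-filter⁺)
open import Data.List.Relation.Unary.Any as Any using (here; there)
open import Data.List.Relation.Unary.All as All using (All; []; _∷_)
open import Data.List.Relation.Unary.All.Properties using (map⁻)
open import Data.List.Relation.Binary.Permutation.Propositional
  using (_↭_; ↭-refl; ↭-prep; ↭-swap; ↭-trans; ↭-sym)
open import Data.List.Relation.Binary.Permutation.Propositional.Properties
  using (All-resp-↭; ↭-length)
open import Data.Rational as ℚ using (ℚ; 0ℚ; 1ℚ; _+_; _*_; -_; _-_; _≤_; _<_; 1/_; ∣_∣; _⊓_)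
import Data.Rational.Properties as ℚ
open import Data.Rational.Solver using (module +-*-Solver)
open import Data.Vec using ([]; _∷_)
open import Data.Vec.Functional using (take; drop; tail; removeAt; _++_)
  renaming (_∷_ to _◂_)
open import Data.Vec.Functional.Properties using (lookup-++ˡ; lookup-++ʳ)
open import Algebra.Bundles using (Ring)
open import Algebra.Properties.Semiring.Sum (Ring.semiring ℚ.+-*-ring)
  using ( sum; sum-cong-≗; sum-remove; sum-replicate-zero
        ; ∑-distrib-+; ∑-comm; *-distribˡ-sum; *-distribʳ-sum)
open import Data.Product as Product using (∃; ∃₂; _×_; _,_; proj₁)
open import Data.Sum as Sum using (_⊎_; inj₁; inj₂; [_,_]′)
open import Data.Empty using (⊥-elim)
open import Function using (_∘_; id)
open import Relation.Nullary using (¬_; yes; no; ¬?)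
open import Relation.Binary.PropositionalEquality
  using (_≡_; _≢_; _≗_; refl; sym; trans; cong; cong₂; subst; subst₂; module ≡-Reasoning)

open +-*-Solver
open ≡-Reasoning

nonneg+nonneg≡0⇒≡0 : ∀ {p q} → 0ℚ ≤ p → 0ℚ ≤ q → p + q ≡ 0ℚ → p ≡ 0ℚ
nonneg+nonneg≡0⇒≡0 {p} {q} p≥0 q≥0 p+q≡0 = ℚ.≤-antisym p≤0 p≥0
  where
  p≤0 : p ≤ 0ℚ
  p≤0 = subst₂ _≤_ (ℚ.+-identityʳ p) p+q≡0 (ℚ.+-monoʳ-≤ p q≥0)

p*q≡0⇒p≡0∨q≡0 : ∀ p q → p * q ≡ 0ℚ → p ≡ 0ℚ ⊎ q ≡ 0ℚ
p*q≡0⇒p≡0∨q≡0 p q pq≡0 with p ℚ.≟ 0ℚ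
... | yes p≡0 = inj₁ p≡0
... | no  p≢0 = inj₂ (begin
  q              ≡⟨ sym (ℚ.*-identityˡ q) ⟩
  1ℚ * q         ≡⟨ cong (_* q) (sym (ℚ.*-inverseˡ p)) ⟩
  (1/ p * p) * q ≡⟨ ℚ.*-assoc (1/ p) p q ⟩
  1/ p * (p * q) ≡⟨ cong (1/ p *_) pq≡0 ⟩
  1/ p * 0ℚ      ≡⟨ ℚ.*-zeroʳ (1/ p) ⟩
  0ℚ             ∎)
  where instance _ = ℚ.≢-nonZero p≢0

*-nonneg : ∀ {p q} → 0ℚ ≤ p → 0ℚ ≤ q → 0ℚ ≤ p * q
*-nonneg {p} {q} p≥0 q≥0 = ℚ.nonNegative⁻¹ _
  {{ℚ.nonNeg*nonNeg⇒nonNeg p {{ℚ.nonNegative p≥0}} q {{ℚ.nonNegative q≥0}}}}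

ℤ→ℚ-neg : ∀ z → ℤ→ℚ (ℤ.- z) ≡ - ℤ→ℚ z
ℤ→ℚ-neg (ℤ.+ zero)  = refl
ℤ→ℚ-neg (ℤ.+ suc n) = refl
ℤ→ℚ-neg ℤ.-[1+ n ]  = sym (solve 1 (λ a → :- (:- a) := a) refl _)

sumℚ≡sum : ∀ {k} (f : Fin k → ℚ) → sumℚ f ≡ sum f
sumℚ≡sum {zero}  f = refl
sumℚ≡sum {suc k} f = cong (f zero +_) (sumℚ≡sum (f ∘ suc))

sum-zero : ∀ {k} {f : Fin k → ℚ} → (∀ i → f i ≡ 0ℚ) → sum f ≡ 0ℚ
sum-zero {k} f≡0 = trans (sum-cong-≗ f≡0) (sum-replicate-zero k)

sum-neg : ∀ {k} (f : Fin k → ℚ) → sum (λ i → - f i) ≡ - sum f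
sum-neg {zero}  f = refl
sum-neg {suc k} f =
  trans (cong (- f zero +_) (sum-neg (f ∘ suc))) (sym (ℚ.neg-distrib-+ (f zero) _))

sum-split : ∀ r {m} (f : Fin (r ℕ.+ m) → ℚ) → sum f ≡ sum (take r f) + sum (drop r f)
sum-split zero    f = sym (ℚ.+-identityˡ _)
sum-split (suc r) f =
  trans (cong (f zero +_) (sum-split r (f ∘ suc))) (sym (ℚ.+-assoc (f zero) _ _))

sum-single : ∀ {k} (f : Fin k → ℚ) (j : Fin k) → (∀ i → i ≢ j → f i ≡ 0ℚ) → sum f ≡ f j
sum-single {suc k} f j f≡0 = begin
  sum f                    ≡⟨ sum-remove {i = j} f ⟩
  f j + sum (removeAt f j) ≡⟨ cong (f j +_) (sum-zero (λ i → f≡0 (punchIn j i) (punchInᵢ≢i j i))) ⟩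
  f j + 0ℚ                 ≡⟨ ℚ.+-identityʳ (f j) ⟩
  f j                      ∎

sum-δ : ∀ {k} (f : Fin k → ℚ) (i : Fin k) → sum (λ j → f j * ℤ→ℚ (δ i j)) ≡ f i
sum-δ f i = trans (sum-single _ i off-diagonal) on-diagonal
  where
  off-diagonal : ∀ j → j ≢ i → f j * ℤ→ℚ (δ i j) ≡ 0ℚ
  off-diagonal j j≢i with i ≟ j
  ... | yes i≡j = ⊥-elim (j≢i (sym i≡j))
  ... | no  _   = ℚ.*-zeroʳ (f j)
  on-diagonal : f i * ℤ→ℚ (δ i i) ≡ f i
  on-diagonal with i ≟ i
  ... | yes _   = ℚ.*-identityʳ (f i)
  ... | no  i≢i = ⊥-elim (i≢i refl)

sum-nonneg : ∀ {k} (f : Fin k → ℚ) → (∀ i → 0ℚ ≤ f i) → 0ℚ ≤ sum f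
sum-nonneg {zero}  f f≥0 = ℚ.≤-refl
sum-nonneg {suc k} f f≥0 = ℚ.+-mono-≤ (f≥0 zero) (sum-nonneg (f ∘ suc) (f≥0 ∘ suc))

sum-nonneg≡0⇒≡0 : ∀ {k} (f : Fin k → ℚ) → (∀ i → 0ℚ ≤ f i) → sum f ≡ 0ℚ → ∀ i → f i ≡ 0ℚ
sum-nonneg≡0⇒≡0 {suc k} f f≥0 Σf≡0 zero =
  nonneg+nonneg≡0⇒≡0 (f≥0 zero) (sum-nonneg (f ∘ suc) (f≥0 ∘ suc)) Σf≡0
sum-nonneg≡0⇒≡0 {suc k} f f≥0 Σf≡0 (suc i) = sum-nonneg≡0⇒≡0 (f ∘ suc) (f≥0 ∘ suc) Σf∘suc≡0 i
  where
  Σf∘suc≡0 : sum (f ∘ suc) ≡ 0ℚ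
  Σf∘suc≡0 = nonneg+nonneg≡0⇒≡0 (sum-nonneg (f ∘ suc) (f≥0 ∘ suc)) (f≥0 zero)
                                 (trans (ℚ.+-comm (sum (f ∘ suc)) (f zero)) Σf≡0)

infix 8 _·_

_·_ : ∀ {d} → Point d → Point d → ℚ
u · v = sum (λ i → u i * v i)

·-congˡ : ∀ {d} {u u′ v : Point d} → u ≗ u′ → u · v ≡ u′ · v
·-congˡ {v = v} u≗u′ = sum-cong-≗ (λ i → cong (_* v i) (u≗u′ i))

·-congʳ : ∀ {d} {u v v′ : Point d} → v ≗ v′ → u · v ≡ u · v′
·-congʳ {u = u} v≗v′ = sum-cong-≗ (λ i → cong (u i *_) (v≗v′ i))

·-comm : ∀ {d} (u v : Point d) → u · v ≡ v · u
·-comm u v = sum-cong-≗ (λ i → ℚ.*-comm (u i) (v i))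

·-distribʳ-+ : ∀ {d} (u v w : Point d) → (λ i → u i + v i) · w ≡ u · w + v · w
·-distribʳ-+ u v w =
  trans (sum-cong-≗ (λ i → ℚ.*-distribʳ-+ (w i) (u i) (v i)))
        (∑-distrib-+ (λ i → u i * w i) (λ i → v i * w i))

·-distribˡ-+ : ∀ {d} (u v w : Point d) → u · (λ i → v i + w i) ≡ u · v + u · w
·-distribˡ-+ u v w =
  trans (sum-cong-≗ (λ i → ℚ.*-distribˡ-+ (u i) (v i) (w i)))
        (∑-distrib-+ (λ i → u i * v i) (λ i → u i * w i))

·-scaleʳ : ∀ {d} (c : ℚ) (u v : Point d) → u · (λ i → c * v i) ≡ c * (u · v)
·-scaleʳ c u v = trans
  (sum-cong-≗ (λ i → solve 3 (λ c x y → x :* (c :* y) := c :* (x :* y)) refl c (u i) (v i)))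
  (sym (*-distribˡ-sum c (λ i → u i * v i)))

·-negˡ : ∀ {d} (u v : Point d) → (λ i → - u i) · v ≡ - (u · v)
·-negˡ u v =
  trans (sum-cong-≗ (λ i → sym (ℚ.neg-distribˡ-* (u i) (v i)))) (sum-neg (λ i → u i * v i))

·-split : ∀ r {m} (u v : Point (r ℕ.+ m)) → u · v ≡ take r u · take r v + drop r u · drop r v
·-split r u v = sum-split r (λ i → u i * v i)

NonZeroᵛ : ∀ {d} → Point d → Set
NonZeroᵛ φ = ∃ λ s → φ s ≢ 0ℚ

column : ∀ {a n} → Matrix a n → Fin n → Point a
column A j i = ℤ→ℚ (A i j)

infixr 9 _*ᵛ_

_*ᵛ_ : ∀ {a n} → Matrix a n → (Fin n → ℚ) → Point a
(A *ᵛ γ) i = sum (λ j → γ j * ℤ→ℚ (A i j))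

·-*ᵛ : ∀ {a n} (φ : Point a) (A : Matrix a n) (γ : Fin n → ℚ) →
       φ · (A *ᵛ γ) ≡ sum (λ j → γ j * (φ · column A j))
·-*ᵛ φ A γ = begin
  sum (λ i → φ i * sum (λ j → γ j * ℤ→ℚ (A i j)))
    ≡⟨ sum-cong-≗ (λ i → *-distribˡ-sum (φ i) (λ j → γ j * ℤ→ℚ (A i j))) ⟩
  sum (λ i → sum (λ j → φ i * (γ j * ℤ→ℚ (A i j))))
    ≡⟨ ∑-comm (λ i j → φ i * (γ j * ℤ→ℚ (A i j))) ⟩
  sum (λ j → sum (λ i → φ i * (γ j * ℤ→ℚ (A i j))))
    ≡⟨ sum-cong-≗ (λ j → ·-scaleʳ (γ j) φ (column A j)) ⟩
  sum (λ j → γ j * (φ · column A j)) ∎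

·-*ᵛ-single : ∀ {a n} (φ : Point a) (A : Matrix a n) (γ : Fin n → ℚ) (j : Fin n) →
              (∀ k → k ≢ j → γ k ≡ 0ℚ ⊎ φ · column A k ≡ 0ℚ) →
              φ · (A *ᵛ γ) ≡ γ j * (φ · column A j)
·-*ᵛ-single φ A γ j negligible = trans (·-*ᵛ φ A γ) (sum-single _ j vanishes)
  where
  vanishes : ∀ k → k ≢ j → γ k * (φ · column A k) ≡ 0ℚ
  vanishes k k≢j with negligible k k≢j
  ... | inj₁ γk≡0 = trans (cong (_* (φ · column A k)) γk≡0) (ℚ.*-zeroˡ (φ · column A k))
  ... | inj₂ φ⊥Ak = trans (cong (γ k *_) φ⊥Ak) (ℚ.*-zeroʳ (γ k))

pivot : ∀ {d} (L : List (Point (suc d))) →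
        All (λ v → v zero ≡ 0ℚ) L ⊎ ∃₂ λ w L′ → w zero ≢ 0ℚ × L ↭ w ∷ L′
pivot []      = inj₁ []
pivot (v ∷ L) with v zero ℚ.≟ 0ℚ
... | no  v₀≢0 = inj₂ (v , L , v₀≢0 , ↭-refl)
... | yes v₀≡0 with pivot L
...   | inj₁ L₀≡0                   = inj₁ (v₀≡0 ∷ L₀≡0)
...   | inj₂ (w , L′ , w₀≢0 , L↭wL′) =
        inj₂ (w , v ∷ L′ , w₀≢0 , ↭-trans (↭-prep v L↭wL′) (↭-swap v w ↭-refl))

module Elimination {d} (w : Point (suc d)) (w₀≢0 : w zero ≢ 0ℚ) where

  instance
    w₀-nonZero : ℚ.NonZero (w zero)
    w₀-nonZero = ℚ.≢-nonZero w₀≢0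

  reduce : Point (suc d) → Point d
  reduce v i = v (suc i) + - (v zero * 1/ w zero) * w (suc i)

  lift : Point d → Point (suc d)
  lift φ = (- (φ · tail w) * 1/ w zero) ◂ φ

  lift-· : ∀ φ v → lift φ · v ≡ φ · reduce v
  lift-· φ v = begin
    (- (φ · tail w) * 1/ w zero) * v zero + φ · tail v
      ≡⟨ solve 4 (λ a b c x → (:- a :* b) :* c :+ x := x :+ (:- (c :* b)) :* a) refl
                 (φ · tail w) (1/ w zero) (v zero) (φ · tail v) ⟩
    φ · tail v + c * (φ · tail w)
      ≡⟨ cong (φ · tail v +_) (sym (·-scaleʳ c φ (tail w))) ⟩
    φ · tail v + φ · (λ i → c * w (suc i))
      ≡⟨ sym (·-distribˡ-+ φ (tail v) (λ i → c * w (suc i))) ⟩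
    φ · reduce v ∎
    where c = - (v zero * 1/ w zero)

  lift-·-pivot : ∀ φ → lift φ · w ≡ 0ℚ
  lift-·-pivot φ = begin
    (- a * 1/ w zero) * w zero + a ≡⟨ cong (_+ a) (ℚ.*-assoc (- a) (1/ w zero) (w zero)) ⟩
    - a * (1/ w zero * w zero) + a ≡⟨ cong (λ c → - a * c + a) (ℚ.*-inverseˡ (w zero)) ⟩
    - a * 1ℚ + a                   ≡⟨ cong (_+ a) (ℚ.*-identityʳ (- a)) ⟩
    - a + a                        ≡⟨ ℚ.+-inverseˡ a ⟩
    0ℚ                             ∎
    where a = φ · tail w

annihilator : ∀ d (L : List (Point d)) → length L ℕ.< d →
              ∃ λ φ → NonZeroᵛ φ × All (λ v → φ · v ≡ 0ℚ) L
annihilator (suc d) L |L|<d with pivot L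
... | inj₁ L₀≡0 = e₀ , (zero , λ ()) , All.map (λ {v} → e₀-· {v}) L₀≡0
  where
  e₀ : Point (suc d)
  e₀ = 1ℚ ◂ λ _ → 0ℚ
  e₀-· : ∀ {v} → v zero ≡ 0ℚ → e₀ · v ≡ 0ℚ
  e₀-· {v} v₀≡0 =
    cong₂ _+_ (trans (ℚ.*-identityˡ (v zero)) v₀≡0) (sum-zero (λ i → ℚ.*-zeroˡ (v (suc i))))
... | inj₂ (w , L′ , w₀≢0 , L↭wL′) =
  let φ , (s , φs≢0) , φ⊥ = annihilator d (map reduce L′) |L′|<d
  in lift φ , (suc s , φs≢0) ,
     All-resp-↭ (↭-sym L↭wL′)
       (lift-·-pivot φ ∷ All.map (λ {v} φ⊥v → trans (lift-· φ v) φ⊥v) (map⁻ φ⊥))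
  where
  open Elimination w w₀≢0
  |L′|<d : length (map reduce L′) ℕ.< d
  |L′|<d = subst (ℕ._< d) (sym (length-map reduce L′))
                 (ℕ.s<s⁻¹ (subst (ℕ._< suc d) (↭-length L↭wL′) |L|<d))

∈ᵇ⇒∈-elems : ∀ {n} (B : Subset n) {k} → k ∈ᵇ B ≡ true → k ∈ elems B
∈ᵇ⇒∈-elems (true  ∷ B) {zero}  _    = here refl
∈ᵇ⇒∈-elems (true  ∷ B) {suc k} k∈B = there (∈-map⁺ suc (∈ᵇ⇒∈-elems B k∈B))
∈ᵇ⇒∈-elems (false ∷ B) {suc k} k∈B = ∈-map⁺ suc (∈ᵇ⇒∈-elems B k∈B)

∈ᵇ-∁ : ∀ {n} (B : Subset n) k → k ∈ᵇ ∁ B ≡ notᵇ (k ∈ᵇ B)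
∈ᵇ-∁ (true  ∷ B) zero    = refl
∈ᵇ-∁ (false ∷ B) zero    = refl
∈ᵇ-∁ (_     ∷ B) (suc k) = ∈ᵇ-∁ B k

length-elems-∁ : ∀ {n} (B : Subset n) → length (elems B) ℕ.+ length (elems (∁ B)) ≡ n
length-elems-∁ []          = refl
length-elems-∁ (true  ∷ B) = cong suc (trans
  (cong₂ ℕ._+_ (length-map suc (elems B)) (length-map suc (elems (∁ B))))
  (length-elems-∁ B))
length-elems-∁ (false ∷ B) = trans
  (cong₂ (λ a b → a ℕ.+ suc b) (length-map suc (elems B)) (length-map suc (elems (∁ B))))
  (trans (ℕ.+-suc (length (elems B)) _) (cong suc (length-elems-∁ B)))

length-elems-∁≡m : ∀ r {m} (B : Subset (r ℕ.+ m)) → r ≡ length (elems B) → length (elems (∁ B)) ≡ m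
length-elems-∁≡m r B |B|≡r =
  ℕ.+-cancelˡ-≡ r _ _ (trans (cong (ℕ._+ length (elems (∁ B))) |B|≡r) (length-elems-∁ B))

column-annihilator : ∀ {a n} (A : Matrix a n) (B : Subset n) {j} →
  length (elems B) ≡ a → j ∈ᵇ B ≡ true →
  ∃ λ φ → NonZeroᵛ φ × (∀ k → k ∈ᵇ B ≡ true → k ≢ j → φ · column A k ≡ 0ℚ)
column-annihilator {a} A B {j} |B|≡a j∈B =
  let φ , φ≢0 , φ⊥ = annihilator a (map (column A) others) |others|<a
  in φ , φ≢0 , λ k k∈B k≢j →
       All.lookup φ⊥ (∈-map⁺ (column A) (∈-filter⁺ ≢j? (∈ᵇ⇒∈-elems B k∈B) k≢j))
  where
  ≢j? = λ k → ¬? (k ≟ j)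
  others = filter ≢j? (elems B)
  |others|<a : length (map (column A) others) ℕ.< a
  |others|<a = subst₂ ℕ._<_ (sym (length-map (column A) others)) |B|≡a
    (filter-notAll ≢j? (elems B) (Any.map (λ j≡k k≢j → k≢j (sym j≡k)) (∈ᵇ⇒∈-elems B j∈B)))

module _ {r m : ℕ} (M : Matrix r m) where

  private
    Mℚ : Fin r → Fin m → ℚ
    Mℚ i k = ℤ→ℚ (M i k)

  Dmat-↑ˡ : ∀ i j → Dmat M i (j ↑ˡ m) ≡ δ i j
  Dmat-↑ˡ i j rewrite splitAt-↑ˡ r j m = refl

  Dmat-↑ʳ : ∀ i k → Dmat M i (r ↑ʳ k) ≡ M i k
  Dmat-↑ʳ i k rewrite splitAt-↑ʳ r m k = refl

  D̂mat-↑ˡ : ∀ k i → D̂mat M k (i ↑ˡ m) ≡ ℤ.- M i k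
  D̂mat-↑ˡ k i rewrite splitAt-↑ˡ r i m = refl

  D̂mat-↑ʳ : ∀ k k′ → D̂mat M k (r ↑ʳ k′) ≡ δ k k′
  D̂mat-↑ʳ k k′ rewrite splitAt-↑ʳ r m k′ = refl

  Dmat-*ᵛ : ∀ γ i → (Dmat M *ᵛ γ) i ≡ take r γ i + sum (λ k → drop r γ k * Mℚ i k)
  Dmat-*ᵛ γ i = trans (sum-split r _) (cong₂ _+_
    (trans (sum-cong-≗ (λ j → cong (λ z → γ (j ↑ˡ m) * ℤ→ℚ z) (Dmat-↑ˡ i j))) (sum-δ (take r γ) i))
    (sum-cong-≗ (λ k → cong (λ z → γ (r ↑ʳ k) * ℤ→ℚ z) (Dmat-↑ʳ i k))))

  D̂mat-*ᵛ : ∀ η k → (D̂mat M *ᵛ η) k ≡ - sum (λ i → take r η i * Mℚ i k) + drop r η k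
  D̂mat-*ᵛ η k = trans (sum-split r _)
    (cong₂ _+_ (trans (sum-cong-≗ left) (sum-neg (λ i → take r η i * Mℚ i k))) right)
    where
    left : ∀ i → η (i ↑ˡ m) * ℤ→ℚ (D̂mat M k (i ↑ˡ m)) ≡ - (take r η i * Mℚ i k)
    left i = begin
      η (i ↑ˡ m) * ℤ→ℚ (D̂mat M k (i ↑ˡ m)) ≡⟨ cong (λ z → η (i ↑ˡ m) * ℤ→ℚ z) (D̂mat-↑ˡ k i) ⟩
      η (i ↑ˡ m) * ℤ→ℚ (ℤ.- M i k)         ≡⟨ cong (η (i ↑ˡ m) *_) (ℤ→ℚ-neg (M i k)) ⟩
      η (i ↑ˡ m) * - Mℚ i k                ≡⟨ sym (ℚ.neg-distribʳ-* (η (i ↑ˡ m)) (Mℚ i k)) ⟩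
      - (η (i ↑ˡ m) * Mℚ i k)              ∎
    right : sum (λ k′ → η (r ↑ʳ k′) * ℤ→ℚ (D̂mat M k (r ↑ʳ k′))) ≡ drop r η k
    right = trans (sum-cong-≗ (λ k′ → cong (λ z → η (r ↑ʳ k′) * ℤ→ℚ z) (D̂mat-↑ʳ k k′)))
                  (sum-δ (drop r η) k)

  pairing : ∀ γ η → (Dmat M *ᵛ γ) · take r η + (D̂mat M *ᵛ η) · drop r γ ≡ γ · η
  pairing γ η = begin
    (Dmat M *ᵛ γ) · η₁ + (D̂mat M *ᵛ η) · γ₂
      ≡⟨ cong₂ _+_ (trans (·-congˡ (Dmat-*ᵛ γ)) (·-distribʳ-+ γ₁ Mγ₂ η₁))
                   (trans (·-congˡ (D̂mat-*ᵛ η)) (·-distribʳ-+ (λ k → - Mᵀη₁ k) η₂ γ₂)) ⟩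
    (γ₁ · η₁ + Mγ₂ · η₁) + ((λ k → - Mᵀη₁ k) · γ₂ + η₂ · γ₂)
      ≡⟨ cong (λ c → (γ₁ · η₁ + Mγ₂ · η₁) + (c + η₂ · γ₂))
              (trans (·-negˡ Mᵀη₁ γ₂) (cong -_ (sym transpose))) ⟩
    (γ₁ · η₁ + Mγ₂ · η₁) + (- (Mγ₂ · η₁) + η₂ · γ₂)
      ≡⟨ solve 3 (λ a c b → (a :+ c) :+ (:- c :+ b) := a :+ b) refl (γ₁ · η₁) (Mγ₂ · η₁) (η₂ · γ₂) ⟩
    γ₁ · η₁ + η₂ · γ₂
      ≡⟨ cong (γ₁ · η₁ +_) (·-comm η₂ γ₂) ⟩
    γ₁ · η₁ + γ₂ · η₂
      ≡⟨ sym (·-split r γ η) ⟩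
    γ · η ∎
    where
    γ₁ = take r γ
    γ₂ = drop r γ
    η₁ = take r η
    η₂ = drop r η
    Mγ₂ : Point r
    Mγ₂ i = sum (λ k → γ₂ k * Mℚ i k)
    Mᵀη₁ : Point m
    Mᵀη₁ k = sum (λ i → η₁ i * Mℚ i k)
    transpose : Mγ₂ · η₁ ≡ Mᵀη₁ · γ₂
    transpose = begin
      sum (λ i → sum (λ k → γ₂ k * Mℚ i k) * η₁ i)
        ≡⟨ sum-cong-≗ (λ i → *-distribʳ-sum (η₁ i) (λ k → γ₂ k * Mℚ i k)) ⟩
      sum (λ i → sum (λ k → γ₂ k * Mℚ i k * η₁ i))
        ≡⟨ ∑-comm (λ i k → γ₂ k * Mℚ i k * η₁ i) ⟩
      sum (λ k → sum (λ i → γ₂ k * Mℚ i k * η₁ i))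
        ≡⟨ sum-cong-≗ (λ k → sum-cong-≗ (λ i →
             solve 3 (λ g a e → g :* a :* e := e :* a :* g) refl (γ₂ k) (Mℚ i k) (η₁ i))) ⟩
      sum (λ k → sum (λ i → η₁ i * Mℚ i k * γ₂ k))
        ≡⟨ sym (sum-cong-≗ (λ k → *-distribʳ-sum (γ₂ k) (λ i → η₁ i * Mℚ i k))) ⟩
      sum (λ k → sum (λ i → η₁ i * Mℚ i k) * γ₂ k) ∎

  pairing-exchange : ∀ {γ γ′ η η′} → Dmat M *ᵛ γ ≗ Dmat M *ᵛ γ′ → D̂mat M *ᵛ η ≗ D̂mat M *ᵛ η′ →
                     γ · η′ + γ′ · η ≡ γ · η + γ′ · η′
  pairing-exchange {γ} {γ′} {η} {η′} y≗y′ z≗z′ = begin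
    γ · η′ + γ′ · η
      ≡⟨ sym (cong₂ _+_ (pairing γ η′) (pairing γ′ η)) ⟩
    (y · take r η′ + z′ · drop r γ) + (y′ · take r η + z · drop r γ′)
      ≡⟨ cong₂ _+_ (cong (y · take r η′ +_) (·-congˡ {v = drop r γ} (sym ∘ z≗z′)))
                   (cong (_+ z · drop r γ′) (·-congˡ {v = take r η} (sym ∘ y≗y′))) ⟩
    (y · take r η′ + z · drop r γ) + (y · take r η + z · drop r γ′)
      ≡⟨ solve 4 (λ a b c d → (a :+ b) :+ (c :+ d) := (c :+ b) :+ (a :+ d)) refl
                 (y · take r η′) (z · drop r γ) (y · take r η) (z · drop r γ′) ⟩
    (y · take r η + z · drop r γ) + (y · take r η′ + z · drop r γ′)
      ≡⟨ cong ((y · take r η + z · drop r γ) +_)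
              (cong₂ _+_ (·-congˡ {v = take r η′} y≗y′) (·-congˡ {v = drop r γ′} z≗z′)) ⟩
    (y · take r η + z · drop r γ) + (y′ · take r η′ + z′ · drop r γ′)
      ≡⟨ cong₂ _+_ (pairing γ η) (pairing γ′ η′) ⟩
    γ · η + γ′ · η′ ∎
    where
    y = Dmat M *ᵛ γ
    y′ = Dmat M *ᵛ γ′
    z = D̂mat M *ᵛ η
    z′ = D̂mat M *ᵛ η′

record Coefficients {a n} (A : Matrix a n) (sel : Fin n → Bool) (x : Point a) : Set where
  field
    γ          : Fin n → ℚ
    nonneg     : ∀ j → 0ℚ ≤ γ j
    support    : ∀ j → sel j ≡ false → γ j ≡ 0ℚ
    represents : x ≗ A *ᵛ γ

open Coefficients

InPar⇒Coefficients : ∀ {a n} {A : Matrix a n} {sel x} → InPar A sel x → Coefficients A sel x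
InPar⇒Coefficients {a} {n} {A} {sel} {x} (c , c∈[0,1] , x≡) = record
  { γ          = γ′
  ; nonneg     = nonneg′
  ; support    = support′
  ; represents = represents′
  }
  where
  γ′ : Fin n → ℚ
  γ′ j = if sel j then c j else 0ℚ
  nonneg′ : ∀ j → 0ℚ ≤ γ′ j
  nonneg′ j with sel j
  ... | true  = proj₁ (c∈[0,1] j)
  ... | false = ℚ.≤-refl
  support′ : ∀ j → sel j ≡ false → γ′ j ≡ 0ℚ
  support′ j sel≡false rewrite sel≡false = refl
  if-* : ∀ {j a} b → (if b then c j * a else 0ℚ) ≡ (if b then c j else 0ℚ) * a
  if-* true  = refl
  if-* {a = a} false = sym (ℚ.*-zeroˡ a)
  terms : Fin a → Fin n → ℚ
  terms i j = if sel j then c j * ℤ→ℚ (A i j) else 0ℚ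
  represents′ : x ≗ A *ᵛ γ′
  represents′ i = begin
    x i            ≡⟨ x≡ i ⟩
    sumℚ (terms i) ≡⟨ sumℚ≡sum (terms i) ⟩
    sum (terms i)  ≡⟨ sum-cong-≗ (λ j → if-* (sel j)) ⟩
    (A *ᵛ γ′) i    ∎

disjoint-supports : ∀ {a a′ n} {A : Matrix a n} {A′ : Matrix a′ n} {B : Subset n} {x x′}
  (c : Coefficients A (_∈ᵇ B) x) (c′ : Coefficients A′ (λ j → notᵇ (j ∈ᵇ B)) x′) →
  ∀ j → γ c j * γ c′ j ≡ 0ℚ
disjoint-supports {B = B} c c′ j with j ∈ᵇ B in j∈B
... | true  = trans (cong (γ c j *_) (support c′ j (cong notᵇ j∈B))) (ℚ.*-zeroʳ (γ c j))
... | false = trans (cong (_* γ c′ j) (support c j j∈B)) (ℚ.*-zeroˡ (γ c′ j))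

·-coefficient : ∀ {a n} {A : Matrix a n} {sel x} (c : Coefficients A sel x) {φ : Point a} {j} →
  (∀ k → sel k ≡ true → k ≢ j → φ · column A k ≡ 0ℚ) → φ · x ≡ γ c j * (φ · column A j)
·-coefficient {A = A} {sel} c {φ} {j} φ⊥ =
  trans (·-congʳ {u = φ} (represents c)) (·-*ᵛ-single φ A (γ c) j negligible)
  where
  negligible : ∀ k → k ≢ j → γ c k ≡ 0ℚ ⊎ φ · column A k ≡ 0ℚ
  negligible k k≢j with sel k in sel-k
  ... | true  = inj₂ (φ⊥ k sel-k k≢j)
  ... | false = inj₁ (support c k sel-k)

complementary-slackness : ∀ {r m} (M : Matrix r m) {B₁ B₂ : Subset (r ℕ.+ m)} {y z}
  (α  : Coefficients (Dmat M) (_∈ᵇ B₁) y) (β  : Coefficients (D̂mat M) (λ j → notᵇ (j ∈ᵇ B₁)) z)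
  (α′ : Coefficients (Dmat M) (_∈ᵇ B₂) y) (β′ : Coefficients (D̂mat M) (λ j → notᵇ (j ∈ᵇ B₂)) z) →
  ∀ j → γ α j * γ β′ j ≡ 0ℚ
complementary-slackness M {B₁} {B₂} α β α′ β′ =
  sum-nonneg≡0⇒≡0 _ αβ′≥0 (nonneg+nonneg≡0⇒≡0 α·β′≥0 α′·β≥0 cross≡0)
  where
  αβ′≥0 : ∀ j → 0ℚ ≤ γ α j * γ β′ j
  αβ′≥0 j = *-nonneg (nonneg α j) (nonneg β′ j)
  α·β′≥0 : 0ℚ ≤ γ α · γ β′
  α·β′≥0 = sum-nonneg _ αβ′≥0
  α′·β≥0 : 0ℚ ≤ γ α′ · γ β
  α′·β≥0 = sum-nonneg _ (λ j → *-nonneg (nonneg α′ j) (nonneg β j))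
  cross≡0 : γ α · γ β′ + γ α′ · γ β ≡ 0ℚ
  cross≡0 = begin
    γ α · γ β′ + γ α′ · γ β
      ≡⟨ pairing-exchange M {γ α} {γ α′} {γ β} {γ β′}
           (λ i → trans (sym (represents α i)) (represents α′ i))
           (λ k → trans (sym (represents β k)) (represents β′ k)) ⟩
    γ α · γ β + γ α′ · γ β′
      ≡⟨ cong₂ _+_ (sum-zero (disjoint-supports {B = B₁} α β))
                   (sum-zero (disjoint-supports {B = B₂} α′ β′)) ⟩
    0ℚ + 0ℚ
      ≡⟨ ℚ.+-identityˡ 0ℚ ⟩
    0ℚ ∎

P∩P⊆hyperplanes : ∀ {r m} (M : Matrix r m) {B₁ B₂ : Subset (r ℕ.+ m)} {j}
                  {φ : Point r} {ψ : Point m} →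
  (∀ k → k ∈ᵇ B₁ ≡ true → k ≢ j → φ · column (Dmat M) k ≡ 0ℚ) →
  (∀ k → notᵇ (k ∈ᵇ B₂) ≡ true → k ≢ j → ψ · column (D̂mat M) k ≡ 0ℚ) →
  ∀ x → P M B₁ x → P M B₂ x → φ · take r x ≡ 0ℚ ⊎ ψ · drop r x ≡ 0ℚ
P∩P⊆hyperplanes {r} M {B₁} {B₂} {j} {φ} {ψ} φ⊥ ψ⊥ x (x₁∈P₁ , x₂∈P₂) (x₁∈P₁′ , x₂∈P₂′) =
  Sum.map on-φ-hyperplane on-ψ-hyperplane
    (p*q≡0⇒p≡0∨q≡0 _ _ (complementary-slackness M {B₁} {B₂} α β α′ β′ j))
  where
  α = InPar⇒Coefficients x₁∈P₁
  β = InPar⇒Coefficients x₂∈P₂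
  α′ = InPar⇒Coefficients x₁∈P₁′
  β′ = InPar⇒Coefficients x₂∈P₂′
  on-φ-hyperplane : γ α j ≡ 0ℚ → φ · take r x ≡ 0ℚ
  on-φ-hyperplane αj≡0 = begin
    φ · take r x                        ≡⟨ ·-coefficient α {φ} φ⊥ ⟩
    γ α j * (φ · column (Dmat M) j)     ≡⟨ cong (_* (φ · column (Dmat M) j)) αj≡0 ⟩
    0ℚ * (φ · column (Dmat M) j)        ≡⟨ ℚ.*-zeroˡ (φ · column (Dmat M) j) ⟩
    0ℚ                                  ∎
  on-ψ-hyperplane : γ β′ j ≡ 0ℚ → ψ · drop r x ≡ 0ℚ
  on-ψ-hyperplane β′j≡0 = begin
    ψ · drop r x                        ≡⟨ ·-coefficient β′ {ψ} ψ⊥ ⟩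
    γ β′ j * (ψ · column (D̂mat M) j)    ≡⟨ cong (_* (ψ · column (D̂mat M) j)) β′j≡0 ⟩
    0ℚ * (ψ · column (D̂mat M) j)        ≡⟨ ℚ.*-zeroˡ (ψ · column (D̂mat M) j) ⟩
    0ℚ                                  ∎

Interior-× : ∀ {k} {S T : Point k → Set} {x} →
             Interior S x → Interior T x → Interior (λ y → S y × T y) x
Interior-× (ε₁ , ε₁>0 , S⊇ball) (ε₂ , ε₂>0 , T⊇ball) =
  ε₁ ⊓ ε₂ , ε>0 ,
  λ y y∈ball → S⊇ball y (λ i → ℚ.<-≤-trans (y∈ball i) (ℚ.p⊓q≤p ε₁ ε₂))
             , T⊇ball y (λ i → ℚ.<-≤-trans (y∈ball i) (ℚ.p⊓q≤q ε₁ ε₂))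
  where
  ε>0 : 0ℚ < ε₁ ⊓ ε₂
  ε>0 with ℚ.⊓-sel ε₁ ε₂
  ... | inj₁ ε≡ε₁ = subst (0ℚ <_) (sym ε≡ε₁) ε₁>0
  ... | inj₂ ε≡ε₂ = subst (0ℚ <_) (sym ε≡ε₂) ε₂>0

avoid-root : ∀ a b {ε} → b ≢ 0ℚ → 0ℚ < ε → ∃ λ t → ∣ t ∣ < ε × a + b * t ≢ 0ℚ
avoid-root a b b≢0 ε>0 with a ℚ.≟ 0ℚ
... | no a≢0 = 0ℚ , ε>0 , λ a+b0≡0 → a≢0 (trans (sym a+b0≡a) a+b0≡0)
  where
  a+b0≡a : a + b * 0ℚ ≡ a
  a+b0≡a = trans (cong (a +_) (ℚ.*-zeroʳ b)) (ℚ.+-identityʳ a)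
... | yes a≡0 with ℚ.<-dense ε>0
...   | t , t>0 , t<ε = t , ∣t∣<ε , a+bt≢0
  where
  ∣t∣<ε : ∣ t ∣ < _
  ∣t∣<ε = subst (_< _) (sym (ℚ.0≤p⇒∣p∣≡p (ℚ.<⇒≤ t>0))) t<ε
  a+bt≡bt : a + b * t ≡ b * t
  a+bt≡bt = trans (cong (_+ b * t) a≡0) (ℚ.+-identityˡ (b * t))
  a+bt≢0 : a + b * t ≢ 0ℚ
  a+bt≢0 a+bt≡0 with p*q≡0⇒p≡0∨q≡0 b t (trans (sym a+bt≡bt) a+bt≡0)
  ... | inj₁ b≡0 = b≢0 b≡0
  ... | inj₂ t≡0 = ℚ.<-irrefl (sym t≡0) t>0

pulse : ∀ {d} → Fin d → ℚ → Point d
pulse s t i with i ≟ s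
... | yes _ = t
... | no  _ = 0ℚ

pulse-small : ∀ {d} (s : Fin d) {t ε} → ∣ t ∣ < ε → 0ℚ < ε → ∀ i → ∣ pulse s t i ∣ < ε
pulse-small s ∣t∣<ε ε>0 i with i ≟ s
... | yes _ = ∣t∣<ε
... | no  _ = ε>0

·-pulse : ∀ {d} (φ : Point d) s t → φ · pulse s t ≡ φ s * t
·-pulse φ s t = trans (sum-single _ s off-s) at-s
  where
  off-s : ∀ i → i ≢ s → φ i * pulse s t i ≡ 0ℚ
  off-s i i≢s with i ≟ s
  ... | yes i≡s = ⊥-elim (i≢s i≡s)
  ... | no  _   = ℚ.*-zeroʳ (φ i)
  at-s : φ s * pulse s t s ≡ φ s * t
  at-s with s ≟ s
  ... | yes _   = refl
  ... | no  s≢s = ⊥-elim (s≢s refl)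

escape : ∀ {d} (φ u : Point d) {ε} → NonZeroᵛ φ → 0ℚ < ε →
         ∃ λ b → (∀ i → ∣ b i ∣ < ε) × φ · (λ i → u i + b i) ≢ 0ℚ
escape φ u (s , φs≢0) ε>0 with avoid-root (φ · u) (φ s) φs≢0 ε>0
... | t , ∣t∣<ε , φ·u+φst≢0 =
  pulse s t , pulse-small s ∣t∣<ε ε>0 , λ e → φ·u+φst≢0 (trans (sym shift) e)
  where
  shift : φ · (λ i → u i + pulse s t i) ≡ φ · u + φ s * t
  shift = trans (·-distribˡ-+ φ u (pulse s t)) (cong (φ · u +_) (·-pulse φ s t))

Interior⇒off-hyperplanes : ∀ {r m} {S : Point (r ℕ.+ m) → Set} {x} {φ : Point r} {ψ : Point m} →
  Interior S x → NonZeroᵛ φ → NonZeroᵛ ψ → ∃ λ y → S y × φ · take r y ≢ 0ℚ × ψ · drop r y ≢ 0ℚ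
Interior⇒off-hyperplanes {r} {m} {x = x} {φ} {ψ} (ε , ε>0 , S⊇ball) φ≢0 ψ≢0
  with escape φ (take r x) φ≢0 ε>0 | escape ψ (drop r x) ψ≢0 ε>0
... | b₁ , b₁<ε , φ·≢0 | b₂ , b₂<ε , ψ·≢0 =
  y , S⊇ball y y∈ball ,
  (λ e → φ·≢0 (trans (sym (·-congʳ {u = φ} take-y)) e)) ,
  (λ e → ψ·≢0 (trans (sym (·-congʳ {u = ψ} drop-y)) e))
  where
  y : Point (r ℕ.+ m)
  y i = x i + (b₁ ++ b₂) i
  take-y : take r y ≗ λ i → take r x i + b₁ i
  take-y i = cong (x (i ↑ˡ m) +_) (lookup-++ˡ b₁ b₂ i)
  drop-y : drop r y ≗ λ k → drop r x k + b₂ k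
  drop-y k = cong (x (r ↑ʳ k) +_) (lookup-++ʳ b₁ b₂ k)
  b<ε : ∀ i → ∣ (b₁ ++ b₂) i ∣ < ε
  b<ε i with splitAt r i
  ... | inj₁ i₁ = b₁<ε i₁
  ... | inj₂ i₂ = b₂<ε i₂
  y∈ball : ∀ i → ∣ y i - x i ∣ < ε
  y∈ball i = subst (λ q → ∣ q ∣ < ε)
                   (solve 2 (λ a b → b := a :+ b :- a) refl (x i) ((b₁ ++ b₂) i)) (b<ε i)

separating-index : ∀ {n} {B₁ B₂ : Subset n} → B₁ ≢ B₂ →
  ∃ λ j → (j ∈ᵇ B₁ ≡ true × j ∈ᵇ B₂ ≡ false) ⊎ (j ∈ᵇ B₂ ≡ true × j ∈ᵇ B₁ ≡ false)
separating-index {B₁ = []}         {[]}         B₁≢B₂ = ⊥-elim (B₁≢B₂ refl)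
separating-index {B₁ = true  ∷ _}  {false ∷ _}  _     = zero , inj₁ (refl , refl)
separating-index {B₁ = false ∷ _}  {true  ∷ _}  _     = zero , inj₂ (refl , refl)
separating-index {B₁ = true  ∷ B₁} {true  ∷ B₂} B₁≢B₂ =
  Product.map suc id (separating-index (B₁≢B₂ ∘ cong (true ∷_)))
separating-index {B₁ = false ∷ B₁} {false ∷ B₂} B₁≢B₂ =
  Product.map suc id (separating-index (B₁≢B₂ ∘ cong (false ∷_)))

interiors-disjoint : ∀ {r m} (M : Matrix r m) (B₁ B₂ : Subset (r ℕ.+ m)) j {x} →
  r ≡ length (elems B₁) → r ≡ length (elems B₂) → j ∈ᵇ B₁ ≡ true → j ∈ᵇ B₂ ≡ false →
  ¬ Interior (λ y → P M B₁ y × P M B₂ y) x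
interiors-disjoint {r} {m} M B₁ B₂ j {x} |B₁| |B₂| j∈B₁ j∉B₂ x° =
  let φ , φ≢0 , φ⊥ = column-annihilator (Dmat M) B₁ (sym |B₁|) j∈B₁
      ψ , ψ≢0 , ψ⊥ = column-annihilator (D̂mat M) (∁ B₂) (length-elems-∁≡m r B₂ |B₂|)
                                         (trans (∈ᵇ-∁ B₂ j) (cong notᵇ j∉B₂))
      y , (y∈P₁ , y∈P₂) , φ·y≢0 , ψ·y≢0 =
        Interior⇒off-hyperplanes {S = λ y → P M B₁ y × P M B₂ y} {x} {φ} {ψ} x° φ≢0 ψ≢0
  in [ φ·y≢0 , ψ·y≢0 ]′
       (P∩P⊆hyperplanes M {B₁} {B₂} {j} {φ} {ψ} φ⊥ (λ k → ψ⊥ k ∘ trans (∈ᵇ-∁ B₂ k)) y y∈P₁ y∈P₂)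

proposition5p7 : (r m : ℕ) (M : Matrix r m) (B₁ B₂ : Subset (r ℕ.+ m)) →
    InBases M B₁ → InBases M B₂ → B₁ ≢ B₂ →
    (x : Point (r ℕ.+ m)) → ¬ (Interior (P M B₁) x × Interior (P M B₂) x)
proposition5p7 r m M B₁ B₂ (|B₁| , _) (|B₂| , _) B₁≢B₂ x (x∈P₁° , x∈P₂°)
  with separating-index B₁≢B₂
... | j , inj₁ (j∈B₁ , j∉B₂) =
  interiors-disjoint M B₁ B₂ j |B₁| |B₂| j∈B₁ j∉B₂ (Interior-× x∈P₁° x∈P₂°)
... | j , inj₂ (j∈B₂ , j∉B₁) =
  interiors-disjoint M B₂ B₁ j |B₂| |B₁| j∈B₂ j∉B₁ (Interior-× x∈P₂° x∈P₁°)
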